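{- Let $G$ be a finite simple connected graph with vertex set $\{v_1,\dots,v_n\}$ and edge set $E$. Then $$M_2(G) \ge \sum_{(i,j)\in E} \sqrt{d_i d_j \mu_i \mu_j},$$ with equality if $G$ is regular or semiregular.
   Context: All graphs are finite, simple and connected with $n\ge 3$ vertices and $m$ edges; $d_i$ denotes the degree of vertex $v_i$, and $(i,j)$ denotes the edge joining $v_i$ and $v_j$; sums over $(i,j)\in E$ run over the edges. $\mu_i$ denotes the average of the degrees of the vertices adjacent to $v_i$. The second Zagreb index is $M_2(G)=\sum_{(i,j)\in E} d_i d_j$. A graph is regular if all vertices have the same degree. A connected graph is bidegreed with degrees $\Delta>\delta$ if every vertex has degree $\Delta$ or $\delta$ and both values occur; a semiregular graph is a connected bidegreed bipartite graph in which all vertices in the same part of the bipartition have the same degree. -}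

module Defs where

open import Data.Nat as ℕ using (ℕ; zero; suc; _<ᵇ_)
open import Data.Bool using (Bool; true; false; if_then_else_; _∧_; T)
open import Data.Fin using (Fin; toℕ)
open import Data.List using (List; []; _∷_; map; concatMap; allFin; foldr)
open import Data.List.Membership.Propositional using (_∈_)
open import Data.Product using (_×_; _,_; ∃; ∃-syntax; Σ-syntax)
open import Data.Integer using (+_)
open import Data.Rational as ℚ using (ℚ; 0ℚ; _/_)
open import Relation.Binary.PropositionalEquality using (_≡_; _≢_)
open import Relation.Binary.Construct.Closure.ReflexiveTransitive using (Star)

ℕtoℚ : ℕ → ℚ
ℕtoℚ k = (+ k) / 1

record Graph (n : ℕ) : Set where
  field
    adj       : Fin n → Fin n → Bool
    symmetric : ∀ i j → adj i j ≡ adj j i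
    loopless  : ∀ i → adj i i ≡ false

module _ {n : ℕ} (G : Graph n) where
  open Graph G

  Adjacent : Fin n → Fin n → Set
  Adjacent i j = T (adj i j)

  Connected : Set
  Connected = ∀ i j → Star Adjacent i j

  deg : Fin n → ℕ
  deg i = foldr ℕ._+_ 0 (map (λ j → if adj i j then 1 else 0) (allFin n))

  nbrDegSum : Fin n → ℕ
  nbrDegSum i = foldr ℕ._+_ 0 (map (λ j → if adj i j then deg j else 0) (allFin n))

  -- μ_i = average degree of the neighbours of v_i (0 for an isolated vertex,
  -- which cannot occur in a connected graph with n ≥ 3)
  μ : Fin n → ℚ
  μ i with deg i
  ... | zero  = 0ℚ
  ... | suc k = (+ nbrDegSum i) / suc k

  edges : List (Fin n × Fin n)
  edges = concatMap (λ i → concatMap (λ j →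
            if (toℕ i <ᵇ toℕ j) ∧ adj i j then (i , j) ∷ [] else [])
            (allFin n)) (allFin n)

  M₂ : ℕ
  M₂ = foldr ℕ._+_ 0 (map (λ e → deg (Data.Product.proj₁ e) ℕ.* deg (Data.Product.proj₂ e)) edges)

  radicand : Fin n × Fin n → ℚ
  radicand (i , j) = ℕtoℚ (deg i ℕ.* deg j) ℚ.* μ i ℚ.* μ j

  regular : Set
  regular = ∃[ k ] (∀ i → deg i ≡ k)

  -- semiregular: bipartite (bipartition given by a 2-colouring), bidegreed
  -- with distinct degrees a ≠ b, all vertices of one part having degree a and
  -- all of the other part degree b (connectedness is assumed separately)
  semiregular : Set
  semiregular = Σ[ c ∈ (Fin n → Bool) ] Σ[ a ∈ ℕ ] Σ[ b ∈ ℕ ]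
    ((∀ i j → Adjacent i j → c i ≢ c j) ×
     a ≢ b ×
     (∀ i → c i ≡ false → deg i ≡ a) ×
     (∀ i → c i ≡ true → deg i ≡ b))

-- Real square roots via rational approximation (no reals in agda-stdlib).
-- For a list L of edges with nonnegative rational radicands r(e):
-- an admissible choice is q with 0 ≤ q e and q e * q e ≤ r e for every e ∈ L,
-- i.e. 0 ≤ q e ≤ √(r e).
module _ {A : Set} (L : List A) (r : A → ℚ) where

  Admissible : (A → ℚ) → Set
  Admissible q = ∀ e → e ∈ L → (0ℚ ℚ.≤ q e) × (q e ℚ.* q e ℚ.≤ r e)

  sumℚ : (A → ℚ) → ℚ
  sumℚ q = foldr ℚ._+_ 0ℚ (map q L)

  -- Σ_{e∈L} √(r e) ≤ M   (the supremum of the sums of admissible q is ≤ M)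
  SumSqrt≤ : ℚ → Set
  SumSqrt≤ M = ∀ q → Admissible q → sumℚ q ℚ.≤ M

  -- Σ_{e∈L} √(r e) ≥ M   (every rational below M is beaten by an admissible sum)
  SumSqrt≥ : ℚ → Set
  SumSqrt≥ M = ∀ s → s ℚ.< M → ∃[ q ] (Admissible q × s ℚ.< sumℚ q)

  SumSqrt≡ : ℚ → Set
  SumSqrt≡ M = SumSqrt≤ M × SumSqrt≥ M

-- On an edge ij the radicand d_i d_j μ_i μ_j equals S_i S_j, where S_i = d_i μ_i is the sum of the
-- degrees of the neighbours of v_i, so AM–GM bounds its square root by (S_i + S_j)/2. Summing over the
-- edges, every vertex i is counted d_i times, giving Σ_i d_i S_i = Σ_i Σ_{j~i} d_i d_j = 2 M₂.
-- When the neighbours of every vertex share one degree (as in regular and semiregular graphs),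
-- S_i = d_i d_j on every edge, the radicand is (d_i d_j)², and the bound is attained.

module Submission where

open import Data.Bool using (Bool; true; false; if_then_else_; _∧_; T)
open import Data.Bool.Properties using (¬-not; T-∧)
open import Data.Empty using (⊥-elim)
open import Data.Fin using (Fin; toℕ)
open import Data.Fin.Properties using (toℕ-injective)
open import Data.Integer as ℤ using (+_)
import Data.Integer.Properties as ℤP
open import Data.Integer.Tactic.RingSolver using (solve-∀)
open import Data.List using (List; []; _∷_; _++_; map; foldr; concatMap; allFin)
open import Data.List.Properties using (map-++)
open import Data.List.Membership.Propositional using (_∈_)
open import Data.List.Membership.Propositional.Properties using (∈-concatMap⁻)
open import Data.List.Relation.Unary.Any using (here; there; satisfied)
open import Data.Nat as ℕ using (ℕ; zero; suc; _<ᵇ_)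
open import Data.Nat.ListAction using (sum)
open import Data.Nat.ListAction.Properties using (sum-++)
import Data.Nat.Properties as ℕP
open import Algebra.Properties.CommutativeSemigroup ℕP.+-commutativeSemigroup
  renaming (interchange to +-interchange)
import Data.Nat.Tactic.RingSolver as ℕ-Solver
open import Data.Product using (_×_; _,_; proj₁; proj₂)
open import Data.Rational as ℚ using (ℚ; 0ℚ; _/_; toℚᵘ)
import Data.Rational.Properties as ℚP
open import Data.Rational.Solver using (module +-*-Solver)
open import Data.Rational.Unnormalised as ℚᵘ using (mkℚᵘ; _≃_; *≡*; *≤*)
import Data.Rational.Unnormalised.Properties as ℚᵘP
open import Data.Sum using (_⊎_; inj₁; inj₂)
open import Data.Unit using (tt)
open import Function.Bundles using (Equivalence)
open import Relation.Binary.PropositionalEquality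
open import Relation.Nullary using (¬_; yes; no)

open import Defs

toℚᵘ-/ : ∀ i d → toℚᵘ (i / suc d) ≃ mkℚᵘ i d
toℚᵘ-/ i d = ℚP.toℚᵘ-fromℚᵘ (mkℚᵘ i d)

ℕtoℚ-homo-+ : ∀ m n → ℕtoℚ (m ℕ.+ n) ≡ ℕtoℚ m ℚ.+ ℕtoℚ n
ℕtoℚ-homo-+ m n = ℚP.toℚᵘ-injective (begin
  toℚᵘ (ℕtoℚ (m ℕ.+ n))             ≈⟨ toℚᵘ-/ (+ (m ℕ.+ n)) 0 ⟩
  mkℚᵘ (+ (m ℕ.+ n)) 0              ≈⟨ *≡* (+-denominators (+ m) (+ n)) ⟩
  mkℚᵘ (+ m) 0 ℚᵘ.+ mkℚᵘ (+ n) 0    ≈⟨ ℚᵘP.+-cong (toℚᵘ-/ (+ m) 0) (toℚᵘ-/ (+ n) 0) ⟨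
  toℚᵘ (ℕtoℚ m) ℚᵘ.+ toℚᵘ (ℕtoℚ n)  ≈⟨ ℚP.toℚᵘ-homo-+ (ℕtoℚ m) (ℕtoℚ n) ⟨
  toℚᵘ (ℕtoℚ m ℚ.+ ℕtoℚ n)          ∎)
  where
  open ℚᵘP.≃-Reasoning
  +-denominators : ∀ a b → (a ℤ.+ b) ℤ.* (+ 1 ℤ.* + 1) ≡ (a ℤ.* + 1 ℤ.+ b ℤ.* + 1) ℤ.* + 1
  +-denominators = solve-∀

ℕtoℚ-homo-* : ∀ m n → ℕtoℚ (m ℕ.* n) ≡ ℕtoℚ m ℚ.* ℕtoℚ n
ℕtoℚ-homo-* m n = ℚP.toℚᵘ-injective (begin
  toℚᵘ (ℕtoℚ (m ℕ.* n))             ≈⟨ toℚᵘ-/ (+ (m ℕ.* n)) 0 ⟩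
  mkℚᵘ (+ (m ℕ.* n)) 0              ≈⟨ *≡* (cong (ℤ._* + 1) (ℤP.pos-* m n)) ⟩
  mkℚᵘ (+ m) 0 ℚᵘ.* mkℚᵘ (+ n) 0    ≈⟨ ℚᵘP.*-cong (toℚᵘ-/ (+ m) 0) (toℚᵘ-/ (+ n) 0) ⟨
  toℚᵘ (ℕtoℚ m) ℚᵘ.* toℚᵘ (ℕtoℚ n)  ≈⟨ ℚP.toℚᵘ-homo-* (ℕtoℚ m) (ℕtoℚ n) ⟨
  toℚᵘ (ℕtoℚ m ℚ.* ℕtoℚ n)          ∎)
  where open ℚᵘP.≃-Reasoning

*-/-cancel : ∀ k x → ℕtoℚ (suc k) ℚ.* ((+ x) / suc k) ≡ ℕtoℚ x
*-/-cancel k x = ℚP.toℚᵘ-injective (begin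
  toℚᵘ (ℕtoℚ (suc k) ℚ.* ((+ x) / suc k))           ≈⟨ ℚP.toℚᵘ-homo-* (ℕtoℚ (suc k)) ((+ x) / suc k) ⟩
  toℚᵘ (ℕtoℚ (suc k)) ℚᵘ.* toℚᵘ ((+ x) / suc k)    ≈⟨ ℚᵘP.*-cong (toℚᵘ-/ (+ suc k) 0) (toℚᵘ-/ (+ x) k) ⟩
  mkℚᵘ (+ suc k) 0 ℚᵘ.* mkℚᵘ (+ x) k               ≈⟨ *≡* (cancel (+ suc k) (+ x)) ⟩
  mkℚᵘ (+ x) 0                                     ≈⟨ toℚᵘ-/ (+ x) 0 ⟨
  toℚᵘ (ℕtoℚ x)                                    ∎)
  where
  open ℚᵘP.≃-Reasoning
  cancel : ∀ a b → (a ℤ.* b) ℤ.* + 1 ≡ b ℤ.* (+ 1 ℤ.* a)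
  cancel = solve-∀

ℕtoℚ-mono-≤ : ∀ {m n} → m ℕ.≤ n → ℕtoℚ m ℚ.≤ ℕtoℚ n
ℕtoℚ-mono-≤ {m} {n} m≤n = ℚP.toℚᵘ-cancel-≤ (begin
  toℚᵘ (ℕtoℚ m)   ≃⟨ toℚᵘ-/ (+ m) 0 ⟩
  mkℚᵘ (+ m) 0    ≤⟨ *≤* (ℤP.*-monoʳ-≤-nonNeg (+ 1) (ℤ.+≤+ m≤n)) ⟩
  mkℚᵘ (+ n) 0    ≃⟨ toℚᵘ-/ (+ n) 0 ⟨
  toℚᵘ (ℕtoℚ n)   ∎)
  where open ℚᵘP.≤-Reasoning

ℕtoℚ-nonNeg : ∀ n → 0ℚ ℚ.≤ ℕtoℚ n
ℕtoℚ-nonNeg n = ℕtoℚ-mono-≤ (ℕ.z≤n {n})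

square-cancel-≤ : ∀ {x y} → 0ℚ ℚ.≤ y → x ℚ.* x ℚ.≤ y ℚ.* y → x ℚ.≤ y
square-cancel-≤ {x} {y} 0≤y x²≤y² with x ℚP.≤? y
... | yes x≤y = x≤y
... | no x≰y = ⊥-elim (ℚP.<-irrefl refl (begin-strict
  x ℚ.* x  ≤⟨ x²≤y² ⟩
  y ℚ.* y  ≤⟨ ℚP.*-monoˡ-≤-nonNeg y {{ℚ.nonNegative 0≤y}} (ℚP.<⇒≤ y<x) ⟩
  y ℚ.* x  <⟨ ℚP.*-monoˡ-<-pos x {{ℚ.positive (ℚP.≤-<-trans 0≤y y<x)}} y<x ⟩
  x ℚ.* x  ∎))
  where
  open ℚP.≤-Reasoning
  y<x : y ℚ.< x
  y<x = ℚP.≰⇒> x≰y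

4mn≤[m+n]²-ordered : ∀ {m n} → m ℕ.≤ n → 4 ℕ.* (m ℕ.* n) ℕ.≤ (m ℕ.+ n) ℕ.* (m ℕ.+ n)
4mn≤[m+n]²-ordered {m} {n} m≤n =
  subst (λ n → 4 ℕ.* (m ℕ.* n) ℕ.≤ (m ℕ.+ n) ℕ.* (m ℕ.+ n)) (ℕP.m+[n∸m]≡n m≤n)
    (ℕP.≤-trans (ℕP.m≤m+n _ _) (ℕP.≤-reflexive (sym (expansion m (n ℕ.∸ m)))))
  where
  expansion : ∀ a k → (a ℕ.+ (a ℕ.+ k)) ℕ.* (a ℕ.+ (a ℕ.+ k)) ≡ 4 ℕ.* (a ℕ.* (a ℕ.+ k)) ℕ.+ k ℕ.* k
  expansion = ℕ-Solver.solve-∀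

4mn≤[m+n]² : ∀ m n → 4 ℕ.* (m ℕ.* n) ℕ.≤ (m ℕ.+ n) ℕ.* (m ℕ.+ n)
4mn≤[m+n]² m n with ℕP.≤-total m n
... | inj₁ m≤n = 4mn≤[m+n]²-ordered m≤n
... | inj₂ n≤m = subst₂ ℕ._≤_ (cong (4 ℕ.*_) (ℕP.*-comm n m)) (cong (λ s → s ℕ.* s) (ℕP.+-comm n m))
                   (4mn≤[m+n]²-ordered n≤m)

am-gm : ∀ q m n → q ℚ.* q ℚ.≤ ℕtoℚ (m ℕ.* n) → ℕtoℚ 2 ℚ.* q ℚ.≤ ℕtoℚ (m ℕ.+ n)
am-gm q m n q²≤mn = square-cancel-≤ (ℕtoℚ-nonNeg (m ℕ.+ n)) (begin
  (two ℚ.* q) ℚ.* (two ℚ.* q)          ≡⟨ rearrange two q ⟩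
  (two ℚ.* two) ℚ.* (q ℚ.* q)          ≤⟨ ℚP.*-monoˡ-≤-nonNeg (two ℚ.* two) q²≤mn ⟩
  (two ℚ.* two) ℚ.* ℕtoℚ (m ℕ.* n)     ≡⟨ cong (ℚ._* ℕtoℚ (m ℕ.* n)) (ℕtoℚ-homo-* 2 2) ⟨
  ℕtoℚ 4 ℚ.* ℕtoℚ (m ℕ.* n)            ≡⟨ ℕtoℚ-homo-* 4 (m ℕ.* n) ⟨
  ℕtoℚ (4 ℕ.* (m ℕ.* n))               ≤⟨ ℕtoℚ-mono-≤ (4mn≤[m+n]² m n) ⟩
  ℕtoℚ ((m ℕ.+ n) ℕ.* (m ℕ.+ n))       ≡⟨ ℕtoℚ-homo-* (m ℕ.+ n) (m ℕ.+ n) ⟩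
  ℕtoℚ (m ℕ.+ n) ℚ.* ℕtoℚ (m ℕ.+ n)    ∎)
  where
  open ℚP.≤-Reasoning
  open +-*-Solver
  two : ℚ
  two = ℕtoℚ 2
  rearrange : ∀ a b → (a ℚ.* b) ℚ.* (a ℚ.* b) ≡ (a ℚ.* a) ℚ.* (b ℚ.* b)
  rearrange = solve 2 (λ a b → (a :* b) :* (a :* b) := (a :* a) :* (b :* b)) refl

private variable
  A B : Set

Σ : List A → (A → ℕ) → ℕ
Σ L f = sum (map f L)

Σ-cong : ∀ L {f g : A → ℕ} → (∀ x → f x ≡ g x) → Σ L f ≡ Σ L g
Σ-cong []      f≗g = refl
Σ-cong (x ∷ L) f≗g = cong₂ ℕ._+_ (f≗g x) (Σ-cong L f≗g)

Σ-zero : (L : List A) → Σ L (λ _ → 0) ≡ 0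
Σ-zero []      = refl
Σ-zero (_ ∷ L) = Σ-zero L

Σ-distrib-+ : ∀ L (f g : A → ℕ) → Σ L (λ x → f x ℕ.+ g x) ≡ Σ L f ℕ.+ Σ L g
Σ-distrib-+ []      f g = refl
Σ-distrib-+ (x ∷ L) f g =
  trans (cong (f x ℕ.+ g x ℕ.+_) (Σ-distrib-+ L f g)) (+-interchange (f x) (g x) (Σ L f) (Σ L g))

*-distribˡ-Σ : ∀ c L (f : A → ℕ) → c ℕ.* Σ L f ≡ Σ L (λ x → c ℕ.* f x)
*-distribˡ-Σ c []      f = ℕP.*-zeroʳ c
*-distribˡ-Σ c (x ∷ L) f =
  trans (ℕP.*-distribˡ-+ c (f x) (Σ L f)) (cong (c ℕ.* f x ℕ.+_) (*-distribˡ-Σ c L f))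

Σ-++ : ∀ L M (f : A → ℕ) → Σ (L ++ M) f ≡ Σ L f ℕ.+ Σ M f
Σ-++ L M f = trans (cong sum (map-++ f L M)) (sum-++ (map f L) (map f M))

Σ-comm : ∀ L (M : List B) (f : A → B → ℕ) →
  Σ L (λ x → Σ M (f x)) ≡ Σ M (λ y → Σ L (λ x → f x y))
Σ-comm []      M f = sym (Σ-zero M)
Σ-comm (x ∷ L) M f =
  trans (cong (Σ M (f x) ℕ.+_) (Σ-comm L M f)) (sym (Σ-distrib-+ M (f x) (λ y → Σ L (λ x → f x y))))

Σ-concatMap : ∀ (h : B → List A) L (f : A → ℕ) →
  Σ (concatMap h L) f ≡ Σ L (λ y → Σ (h y) f)
Σ-concatMap h []      f = refl
Σ-concatMap h (y ∷ L) f =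
  trans (Σ-++ (h y) (concatMap h L) f) (cong (Σ (h y) f ℕ.+_) (Σ-concatMap h L f))

Σ-if-singleton : ∀ b x (f : A → ℕ) → Σ (if b then x ∷ [] else []) f ≡ (if b then f x else 0)
Σ-if-singleton true  x f = ℕP.+-identityʳ (f x)
Σ-if-singleton false x f = refl

Σ-restrict-zero : ∀ L (p : A → Bool) (f : A → ℕ) →
  Σ L (λ x → if p x then 1 else 0) ≡ 0 → Σ L (λ x → if p x then f x else 0) ≡ 0
Σ-restrict-zero []      p f _ = refl
Σ-restrict-zero (x ∷ L) p f count≡0 with p x
... | false = Σ-restrict-zero L p f count≡0
... | true  = ⊥-elim (ℕP.1+n≢0 count≡0)

Σℚ : List A → (A → ℚ) → ℚ
Σℚ L f = foldr ℚ._+_ 0ℚ (map f L)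

Σℚ-mono-≤ : ∀ L {f g : A → ℚ} → (∀ x → x ∈ L → f x ℚ.≤ g x) → Σℚ L f ℚ.≤ Σℚ L g
Σℚ-mono-≤ []      f≤g = ℚP.≤-refl
Σℚ-mono-≤ (x ∷ L) f≤g = ℚP.+-mono-≤ (f≤g x (here refl)) (Σℚ-mono-≤ L (λ y y∈L → f≤g y (there y∈L)))

*-distribˡ-Σℚ : ∀ c L (f : A → ℚ) → c ℚ.* Σℚ L f ≡ Σℚ L (λ x → c ℚ.* f x)
*-distribˡ-Σℚ c []      f = ℚP.*-zeroʳ c
*-distribˡ-Σℚ c (x ∷ L) f =
  trans (ℚP.*-distribˡ-+ c (f x) (Σℚ L f)) (cong (c ℚ.* f x ℚ.+_) (*-distribˡ-Σℚ c L f))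

ℕtoℚ-Σ : ∀ L (f : A → ℕ) → ℕtoℚ (Σ L f) ≡ Σℚ L (λ x → ℕtoℚ (f x))
ℕtoℚ-Σ []      f = refl
ℕtoℚ-Σ (x ∷ L) f = trans (ℕtoℚ-homo-+ (f x) (Σ L f)) (cong (ℕtoℚ (f x) ℚ.+_) (ℕtoℚ-Σ L f))

<ᵇ≡true⇒< : ∀ m n → (m <ᵇ n) ≡ true → m ℕ.< n
<ᵇ≡true⇒< m n eq = ℕP.<ᵇ⇒< m n (subst T (sym eq) tt)

<ᵇ≡false⇒≮ : ∀ m n → (m <ᵇ n) ≡ false → ¬ m ℕ.< n
<ᵇ≡false⇒≮ m n eq m<n = subst T eq (ℕP.<⇒<ᵇ m<n)

if-scale : ∀ b {x} c → (T b → x ≡ c) → (if b then x else 0) ≡ c ℕ.* (if b then 1 else 0)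
if-scale true  c x≡c = trans (x≡c tt) (sym (ℕP.*-identityʳ c))
if-scale false c _   = sym (ℕP.*-zeroʳ c)

module _ {n : ℕ} (G : Graph n) where
  open Graph G

  private
    V : List (Fin n)
    V = allFin n

  nbrDegSum-isolated : ∀ i → deg G i ≡ 0 → nbrDegSum G i ≡ 0
  nbrDegSum-isolated i = Σ-restrict-zero V (adj i) (deg G)

  -- μ is 0 at an isolated vertex, where nbrDegSum vanishes as well
  deg-*-μ : ∀ i → ℕtoℚ (deg G i) ℚ.* μ G i ≡ ℕtoℚ (nbrDegSum G i)
  deg-*-μ i with deg G i in isolated
  ... | zero  = cong ℕtoℚ (sym (nbrDegSum-isolated i isolated))
  ... | suc k = *-/-cancel k (nbrDegSum G i)

  radicand≡ : ∀ i j → radicand G (i , j) ≡ ℕtoℚ (nbrDegSum G i ℕ.* nbrDegSum G j)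
  radicand≡ i j = begin
    ℕtoℚ (deg G i ℕ.* deg G j) ℚ.* μ G i ℚ.* μ G j
      ≡⟨ cong (λ x → x ℚ.* μ G i ℚ.* μ G j) (ℕtoℚ-homo-* (deg G i) (deg G j)) ⟩
    ℕtoℚ (deg G i) ℚ.* ℕtoℚ (deg G j) ℚ.* μ G i ℚ.* μ G j
      ≡⟨ rearrange (ℕtoℚ (deg G i)) (ℕtoℚ (deg G j)) (μ G i) (μ G j) ⟩
    (ℕtoℚ (deg G i) ℚ.* μ G i) ℚ.* (ℕtoℚ (deg G j) ℚ.* μ G j)
      ≡⟨ cong₂ ℚ._*_ (deg-*-μ i) (deg-*-μ j) ⟩
    ℕtoℚ (nbrDegSum G i) ℚ.* ℕtoℚ (nbrDegSum G j)
      ≡⟨ ℕtoℚ-homo-* (nbrDegSum G i) (nbrDegSum G j) ⟨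
    ℕtoℚ (nbrDegSum G i ℕ.* nbrDegSum G j) ∎
    where
    open ≡-Reasoning
    open +-*-Solver
    rearrange : ∀ a b c d → a ℚ.* b ℚ.* c ℚ.* d ≡ (a ℚ.* c) ℚ.* (b ℚ.* d)
    rearrange = solve 4 (λ a b c d → a :* b :* c :* d := (a :* c) :* (b :* d)) refl

  edge? : Fin n → Fin n → Bool
  edge? i j = (toℕ i <ᵇ toℕ j) ∧ adj i j

  Σ-edges : ∀ (F : Fin n × Fin n → ℕ) → Σ (edges G) F ≡ Σ V (λ i → Σ V (λ j → if edge? i j then F (i , j) else 0))
  Σ-edges F = trans (Σ-concatMap _ V F) (Σ-cong V λ i →
    trans (Σ-concatMap _ V F) (Σ-cong V λ j → Σ-if-singleton (edge? i j) (i , j) F))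

  edge?-split : ∀ i j x →
    (if edge? i j then x else 0) ℕ.+ (if edge? j i then x else 0) ≡ (if adj i j then x else 0)
  edge?-split i j x rewrite symmetric j i with toℕ i <ᵇ toℕ j in i<j | toℕ j <ᵇ toℕ i in j<i
  ... | true  | true  = ⊥-elim (ℕP.<-asym (<ᵇ≡true⇒< (toℕ i) (toℕ j) i<j) (<ᵇ≡true⇒< (toℕ j) (toℕ i) j<i))
  ... | true  | false = ℕP.+-identityʳ _
  ... | false | true  = refl
  ... | false | false = cong (λ b → if b then x else 0) (sym (subst (λ k → adj i k ≡ false) i≡j (loopless i)))
    where
    i≡j : i ≡ j
    i≡j = toℕ-injective (ℕP.≤-antisym (ℕP.≮⇒≥ (<ᵇ≡false⇒≮ (toℕ j) (toℕ i) j<i))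
                                        (ℕP.≮⇒≥ (<ᵇ≡false⇒≮ (toℕ i) (toℕ j) i<j)))

  Σ-arcs : (Fin n → Fin n → ℕ) → ℕ
  Σ-arcs g = Σ V (λ i → Σ V (λ j → if adj i j then g i j else 0))

  Σ-edges-both-ends : ∀ (g : Fin n → Fin n → ℕ) → Σ (edges G) (λ (i , j) → g i j ℕ.+ g j i) ≡ Σ-arcs g
  Σ-edges-both-ends g = begin
    Σ (edges G) (λ (i , j) → g i j ℕ.+ g j i)
      ≡⟨ Σ-edges _ ⟩
    Σ V (λ i → Σ V (λ j → if edge? i j then g i j ℕ.+ g j i else 0))
      ≡⟨ Σ-cong V (λ i → trans (Σ-cong V (λ j → if-+ (edge? i j))) (Σ-distrib-+ V _ _)) ⟩
    Σ V (λ i → forward i ℕ.+ Σ V (λ j → if edge? i j then g j i else 0))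
      ≡⟨ Σ-distrib-+ V forward _ ⟩
    Σ V forward ℕ.+ Σ V (λ i → Σ V (λ j → if edge? i j then g j i else 0))
      ≡⟨ cong (Σ V forward ℕ.+_) (Σ-comm V V (λ i j → if edge? i j then g j i else 0)) ⟩
    Σ V forward ℕ.+ Σ V backward
      ≡⟨ Σ-distrib-+ V forward backward ⟨
    Σ V (λ i → forward i ℕ.+ backward i)
      ≡⟨ Σ-cong V (λ i → trans (sym (Σ-distrib-+ V _ _)) (Σ-cong V (λ j → edge?-split i j (g i j)))) ⟩
    Σ-arcs g ∎
    where
    open ≡-Reasoning
    forward backward : Fin n → ℕ
    forward  i = Σ V (λ j → if edge? i j then g i j else 0)
    backward i = Σ V (λ j → if edge? j i then g i j else 0)
    if-+ : ∀ b {x y} → (if b then x ℕ.+ y else 0) ≡ (if b then x else 0) ℕ.+ (if b then y else 0)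
    if-+ true  = refl
    if-+ false = refl

  Σ-arcs-factor : ∀ (f h : Fin n → ℕ) →
    Σ-arcs (λ i j → f i ℕ.* h j) ≡ Σ V (λ i → f i ℕ.* Σ V (λ j → if adj i j then h j else 0))
  Σ-arcs-factor f h = Σ-cong V λ i →
    trans (Σ-cong V (λ j → if-* (adj i j) (f i) (h j))) (sym (*-distribˡ-Σ (f i) V _))
    where
    if-* : ∀ b x y → (if b then x ℕ.* y else 0) ≡ x ℕ.* (if b then y else 0)
    if-* true  x y = refl
    if-* false x y = sym (ℕP.*-zeroʳ x)

  Σ-edges-nbrDegSum : Σ (edges G) (λ (i , j) → nbrDegSum G i ℕ.+ nbrDegSum G j) ≡ 2 ℕ.* M₂ G
  Σ-edges-nbrDegSum = begin
    Σ (edges G) (λ (i , j) → S i ℕ.+ S j)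
      ≡⟨ Σ-cong (edges G) (λ (i , j) → sym (cong₂ ℕ._+_ (ℕP.*-identityʳ (S i)) (ℕP.*-identityʳ (S j)))) ⟩
    Σ (edges G) (λ (i , j) → S i ℕ.* 1 ℕ.+ S j ℕ.* 1)
      ≡⟨ Σ-edges-both-ends (λ i _ → S i ℕ.* 1) ⟩
    Σ-arcs (λ i _ → S i ℕ.* 1)
      ≡⟨ Σ-arcs-factor S (λ _ → 1) ⟩
    Σ V (λ i → S i ℕ.* d i)
      ≡⟨ Σ-cong V (λ i → ℕP.*-comm (S i) (d i)) ⟩
    Σ V (λ i → d i ℕ.* S i)
      ≡⟨ Σ-arcs-factor d d ⟨
    Σ-arcs (λ i j → d i ℕ.* d j)
      ≡⟨ Σ-edges-both-ends (λ i j → d i ℕ.* d j) ⟨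
    Σ (edges G) (λ (i , j) → d i ℕ.* d j ℕ.+ d j ℕ.* d i)
      ≡⟨ Σ-distrib-+ (edges G) _ _ ⟩
    M₂ G ℕ.+ Σ (edges G) (λ (i , j) → d j ℕ.* d i)
      ≡⟨ cong (M₂ G ℕ.+_) (Σ-cong (edges G) (λ (i , j) → ℕP.*-comm (d j) (d i))) ⟩
    M₂ G ℕ.+ M₂ G
      ≡⟨ cong (M₂ G ℕ.+_) (ℕP.+-identityʳ (M₂ G)) ⟨
    2 ℕ.* M₂ G ∎
    where
    open ≡-Reasoning
    d S : Fin n → ℕ
    d = deg G
    S = nbrDegSum G

  ∈-edges⇒Adjacent : ∀ {e} → e ∈ edges G → Adjacent G (proj₁ e) (proj₂ e)
  ∈-edges⇒Adjacent e∈ with satisfied (∈-concatMap⁻ _ {xs = V} e∈)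
  ... | i , e∈ᵢ with satisfied (∈-concatMap⁻ _ {xs = V} e∈ᵢ)
  ... | j , e∈ᵢⱼ = listed e∈ᵢⱼ
    where
    listed : ∀ {e} → e ∈ (if edge? i j then (i , j) ∷ [] else []) → Adjacent G (proj₁ e) (proj₂ e)
    listed e∈ with edge? i j in ij
    listed (here refl) | true = proj₂ (Equivalence.to T-∧ (subst T (sym ij) tt))

  Adjacent-sym : ∀ {i j} → Adjacent G i j → Adjacent G j i
  Adjacent-sym {i} {j} = subst T (symmetric i j)

  NeighboursShareDegree : Set
  NeighboursShareDegree = ∀ {i j k} → Adjacent G i j → Adjacent G i k → deg G j ≡ deg G k

  regular⇒NeighboursShareDegree : regular G → NeighboursShareDegree
  regular⇒NeighboursShareDegree (r , deg≡r) {j = j} {k} _ _ = trans (deg≡r j) (sym (deg≡r k))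

  semiregular⇒NeighboursShareDegree : semiregular G → NeighboursShareDegree
  semiregular⇒NeighboursShareDegree (c , a , b , proper , _ , deg-false , deg-true) {i} {j} {k} i~j i~k =
    trans (deg-by-colour j) (trans (cong (λ x → if x then b else a) same-colour) (sym (deg-by-colour k)))
    where
    deg-by-colour : ∀ v → deg G v ≡ (if c v then b else a)
    deg-by-colour v with c v in cv
    ... | false = deg-false v cv
    ... | true  = deg-true v cv
    same-colour : c j ≡ c k
    same-colour = trans (¬-not (≢-sym (proper i j i~j))) (sym (¬-not (≢-sym (proper i k i~k))))

  nbrDegSum-edge : NeighboursShareDegree → ∀ {i j} → Adjacent G i j → nbrDegSum G i ≡ deg G i ℕ.* deg G j
  nbrDegSum-edge share {i} {j} i~j = begin
    Σ V (λ k → if adj i k then deg G k else 0)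
      ≡⟨ Σ-cong V (λ k → if-scale (adj i k) (deg G j) (λ i~k → share i~k i~j)) ⟩
    Σ V (λ k → deg G j ℕ.* (if adj i k then 1 else 0))
      ≡⟨ *-distribˡ-Σ (deg G j) V _ ⟨
    deg G j ℕ.* deg G i
      ≡⟨ ℕP.*-comm (deg G j) (deg G i) ⟩
    deg G i ℕ.* deg G j ∎
    where open ≡-Reasoning

  Σ√radicand≤M₂ : SumSqrt≤ (edges G) (radicand G) (ℕtoℚ (M₂ G))
  Σ√radicand≤M₂ q admissible = ℚP.*-cancelˡ-≤-pos (ℕtoℚ 2) (begin
    ℕtoℚ 2 ℚ.* Σℚ (edges G) q                          ≡⟨ *-distribˡ-Σℚ (ℕtoℚ 2) (edges G) q ⟩
    Σℚ (edges G) (λ e → ℕtoℚ 2 ℚ.* q e)                ≤⟨ Σℚ-mono-≤ (edges G) edge-bound ⟩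
    Σℚ (edges G) (λ e → ℕtoℚ (S-sum e))                ≡⟨ ℕtoℚ-Σ (edges G) S-sum ⟨
    ℕtoℚ (Σ (edges G) S-sum)                           ≡⟨ cong ℕtoℚ (Σ-edges-nbrDegSum) ⟩
    ℕtoℚ (2 ℕ.* M₂ G)                                  ≡⟨ ℕtoℚ-homo-* 2 (M₂ G) ⟩
    ℕtoℚ 2 ℚ.* ℕtoℚ (M₂ G)                             ∎)
    where
    open ℚP.≤-Reasoning
    S-sum : Fin n × Fin n → ℕ
    S-sum (i , j) = nbrDegSum G i ℕ.+ nbrDegSum G j
    edge-bound : ∀ e → e ∈ edges G → ℕtoℚ 2 ℚ.* q e ℚ.≤ ℕtoℚ (S-sum e)
    edge-bound (i , j) e∈ =
      am-gm (q (i , j)) (nbrDegSum G i) (nbrDegSum G j) (subst (_ ℚ.≤_) (radicand≡ i j) (proj₂ (admissible (i , j) e∈)))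

  M₂≤Σ√radicand : NeighboursShareDegree → SumSqrt≥ (edges G) (radicand G) (ℕtoℚ (M₂ G))
  M₂≤Σ√radicand share s s<M₂ = q , admissible , subst (s ℚ.<_) (ℕtoℚ-Σ (edges G) _) s<M₂
    where
    q : Fin n × Fin n → ℚ
    q (i , j) = ℕtoℚ (deg G i ℕ.* deg G j)
    admissible : Admissible (edges G) (radicand G) q
    admissible (i , j) e∈ = ℕtoℚ-nonNeg (deg G i ℕ.* deg G j) , ℚP.≤-reflexive (begin
      q (i , j) ℚ.* q (i , j)                              ≡⟨ ℕtoℚ-homo-* (deg G i ℕ.* deg G j) _ ⟨
      ℕtoℚ ((deg G i ℕ.* deg G j) ℕ.* (deg G i ℕ.* deg G j))
        ≡⟨ cong ℕtoℚ (cong₂ ℕ._*_ (sym (nbrDegSum-edge share i~j))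
             (trans (ℕP.*-comm (deg G i) (deg G j)) (sym (nbrDegSum-edge share (Adjacent-sym i~j))))) ⟩
      ℕtoℚ (nbrDegSum G i ℕ.* nbrDegSum G j)               ≡⟨ radicand≡ i j ⟨
      radicand G (i , j)                                   ∎)
      where
      open ≡-Reasoning
      i~j : Adjacent G i j
      i~j = ∈-edges⇒Adjacent e∈

proposition1 : (n : ℕ) → n ℕ.≥ 3 → (G : Graph n) → Connected G →
    SumSqrt≤ (edges G) (radicand G) (ℕtoℚ (M₂ G)) ×
    (regular G ⊎ semiregular G → SumSqrt≡ (edges G) (radicand G) (ℕtoℚ (M₂ G)))
proposition1 n _ G _ = Σ√radicand≤M₂ G , λ regular-or-semiregular →
  Σ√radicand≤M₂ G , M₂≤Σ√radicand G (share regular-or-semiregular)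
  where
  share : regular G ⊎ semiregular G → NeighboursShareDegree G
  share (inj₁ reg)  = regular⇒NeighboursShareDegree G reg
  share (inj₂ sreg) = semiregular⇒NeighboursShareDegree G sreg
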